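{- Let $\mathcal{E}_1=(E_1,\le_1,\#_1)$ and $\mathcal{E}_2=(E_2,\le_2,\#_2)$ be event structures. Then their sequential composition $\mathcal{E}_1;\mathcal{E}_2$ is an event structure.
   Context: An event structure is $(E,\le,\#)$ with $\le$ a partial order, $\#\subseteq E\times E$ symmetric and irreflexive, $\{e':e'\le e\}$ finite for all $e$, and $e\#e'\le e''\Rightarrow e\#e''$. Configurations: conflict-free down-closed subsets; $\mathcal{C}$ = finite configurations; a finite configuration $x$ is maximal if there is no finite configuration $y$ with $x\subsetneq y$ and no configuration strictly between; $\mathcal{C}_{\max}$ the set of maximal finite configurations. Sequential composition $\mathcal{E}_1;\mathcal{E}_2=(E,\le,\#)$: $E=E_1\uplus(E_2\times\mathcal{C}_{\max}(\mathcal{E}_1))$ (tagged disjoint union); $\le$ consists of $e\le e'$ for $e\le_1e'$ in $E_1$, $(e_2,x)\le(e_2',x)$ for $e_2\le_2e_2'$, and $e_1\le(e_2,x)$ whenever $e_1\in x$; $e\#e'$ iff there exist $e_1\le e$ and $e_1'\le e'$ with $e_1,e_1'\in E_1$ and $e_1\#_1e_1'$, or $e=(e_2,x)$, $e'=(e_2',x)$ with $e_2\#_2e_2'$. -}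

module Defs where

open import Level using (Level; _⊔_; suc)
open import Data.Product using (Σ; ∃; _×_; _,_; proj₁)
open import Data.Sum using (_⊎_; inj₁; inj₂)
open import Data.List using (List)
open import Data.List.Membership.Propositional using (_∈_)
open import Relation.Nullary using (¬_)
open import Relation.Unary using (Pred)
open import Relation.Binary using (Rel)
open import Relation.Binary.PropositionalEquality using (_≡_)

Finite : ∀ {a p} {E : Set a} → Pred E p → Set (a ⊔ p)
Finite {E = E} P = ∃ λ (xs : List E) → ∀ e → (P e → e ∈ xs) × (e ∈ xs → P e)

record IsEventStructure {a ℓ} (E : Set a) (_≤_ : Rel E ℓ) (_#_ : Rel E ℓ) : Set (a ⊔ ℓ) where
  field
    ≤-refl    : ∀ e → e ≤ e
    ≤-antisym : ∀ {e e'} → e ≤ e' → e' ≤ e → e ≡ e'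
    ≤-trans   : ∀ {e e' e''} → e ≤ e' → e' ≤ e'' → e ≤ e''
    #-sym     : ∀ {e e'} → e # e' → e' # e
    #-irrefl  : ∀ e → ¬ (e # e)
    finite-↓  : ∀ e → Finite (λ e' → e' ≤ e)
    #-inherit : ∀ {e e' e''} → e # e' → e' ≤ e'' → e # e''

record EventStructure (a ℓ : Level) : Set (suc (a ⊔ ℓ)) where
  field
    Ev   : Set a
    _≤_  : Rel Ev ℓ
    _#_  : Rel Ev ℓ
    isEventStructure : IsEventStructure Ev _≤_ _#_
  open IsEventStructure isEventStructure public

module _ {a ℓ} (𝓔 : EventStructure a ℓ) where
  open EventStructure 𝓔

  Subset : Set (suc (a ⊔ ℓ))
  Subset = Pred Ev (a ⊔ ℓ)

  _⊆_ : Subset → Subset → Set (a ⊔ ℓ)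
  x ⊆ y = ∀ e → x e → y e

  _⊊_ : Subset → Subset → Set (a ⊔ ℓ)
  x ⊊ y = x ⊆ y × ∃ λ e → y e × ¬ x e

  IsConfig : Subset → Set (a ⊔ ℓ)
  IsConfig x = (∀ e e' → x e → x e' → ¬ (e # e'))
             × (∀ e e' → e' ≤ e → x e → x e')

  IsFiniteConfig : Subset → Set (a ⊔ ℓ)
  IsFiniteConfig x = IsConfig x × Finite x

  -- Maximal finite configuration, literally as in the paper: a finite
  -- configuration x with no finite configuration y such that x ⊊ y and
  -- no configuration lies strictly between x and y.
  IsMaxFiniteConfig : Subset → Set (suc (a ⊔ ℓ))
  IsMaxFiniteConfig x =
    IsFiniteConfig x ×
    ¬ (Σ Subset λ y → IsFiniteConfig y × x ⊊ y ×
         ¬ (Σ Subset λ z → IsConfig z × x ⊊ z × z ⊊ y))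

  Cmax : Set (suc (a ⊔ ℓ))
  Cmax = Σ Subset IsMaxFiniteConfig

module Seq {a₁ ℓ₁ a₂ ℓ₂} (𝓔₁ : EventStructure a₁ ℓ₁) (𝓔₂ : EventStructure a₂ ℓ₂) where
  private
    module E₁ = EventStructure 𝓔₁
    module E₂ = EventStructure 𝓔₂

  A L : Level
  A = a₂ ⊔ suc (a₁ ⊔ ℓ₁)
  L = a₂ ⊔ ℓ₂ ⊔ suc (a₁ ⊔ ℓ₁)

  SeqEv : Set A
  SeqEv = E₁.Ev ⊎ (E₂.Ev × Cmax 𝓔₁)

  data _≤ₛ_ : SeqEv → SeqEv → Set L where
    ≤-left  : ∀ {e e'} → e E₁.≤ e' → inj₁ e ≤ₛ inj₁ e'
    ≤-right : ∀ {e₂ e₂' x} → e₂ E₂.≤ e₂' → inj₂ (e₂ , x) ≤ₛ inj₂ (e₂' , x)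
    ≤-cross : ∀ {e₁ e₂ x} → proj₁ x e₁ → inj₁ e₁ ≤ₛ inj₂ (e₂ , x)

  data _#ₛ_ : SeqEv → SeqEv → Set L where
    #-left  : ∀ {e e'} e₁ e₁' → inj₁ e₁ ≤ₛ e → inj₁ e₁' ≤ₛ e' → e₁ E₁.# e₁' → e #ₛ e'
    #-right : ∀ {e₂ e₂' x} → e₂ E₂.# e₂' → inj₂ (e₂ , x) #ₛ inj₂ (e₂' , x)

-- The order of 𝓔₁ ; 𝓔₂ places a copy of 𝓔₂ above each maximal finite configuration
-- x of 𝓔₁. Transitivity across the seam holds because x is down-closed; a
-- conflict inherited from 𝓔₁ can never make an event of a copy self-conflicting
-- because x is conflict-free; and the down-set of (e₂ , x) is x together with
-- the down-set of e₂ in its copy, finite because x is.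
module Submission where

open import Defs
open import Level using (Level)
open import Data.Empty using (⊥-elim)
open import Data.Product using (_×_; _,_; proj₁; proj₂)
open import Data.Sum using (_⊎_; inj₁; inj₂)
open import Data.List using ([]; map; _++_)
open import Data.List.Membership.Propositional using (_∈_)
open import Data.List.Membership.Propositional.Properties using (∈-map⁺; ∈-map⁻; ∈-++⁺ˡ; ∈-++⁺ʳ; ∈-++⁻)
open import Function using (_∘_)
open import Relation.Nullary using (¬_)
open import Relation.Unary using (Pred)
open import Relation.Binary.PropositionalEquality using (_≡_; refl; cong)

private
  variable
    a b c p q : Level
    A : Set a
    B : Set b
    C : Set c

Finite-resp : {P : Pred A p} {Q : Pred A q} →
              (∀ e → P e → Q e) → (∀ e → Q e → P e) → Finite P → Finite Q
Finite-resp P⇒Q Q⇒P (xs , hxs) =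
  xs , λ e → proj₁ (hxs e) ∘ Q⇒P e , P⇒Q e ∘ proj₂ (hxs e)

Finite-∅ : {P : Pred A p} → (∀ e → ¬ P e) → Finite P
Finite-∅ ¬P = [] , λ e → (λ Pe → ⊥-elim (¬P e Pe)) , λ ()

Finite-⊎ : {P : Pred (A ⊎ B) p} → Finite (P ∘ inj₁) → Finite (P ∘ inj₂) → Finite P
Finite-⊎ {P = P} (xs , hxs) (ys , hys) = map inj₁ xs ++ map inj₂ ys , λ e → to e , from e
  where
  to : ∀ e → P e → e ∈ map inj₁ xs ++ map inj₂ ys
  to (inj₁ x) Pe = ∈-++⁺ˡ (∈-map⁺ inj₁ (proj₁ (hxs x) Pe))
  to (inj₂ y) Pe = ∈-++⁺ʳ (map inj₁ xs) (∈-map⁺ inj₂ (proj₁ (hys y) Pe))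

  from : ∀ e → e ∈ map inj₁ xs ++ map inj₂ ys → P e
  from e e∈ with ∈-++⁻ (map inj₁ xs) e∈
  ... | inj₁ e∈xs with ∈-map⁻ inj₁ e∈xs
  ...   | x , x∈xs , refl = proj₂ (hxs x) x∈xs
  from e e∈ | inj₂ e∈ys with ∈-map⁻ inj₂ e∈ys
  ...   | y , y∈ys , refl = proj₂ (hys y) y∈ys

Finite-×-fibre : {Q : Pred B q} (z : C) → Finite Q → Finite (λ (e : B × C) → Q (proj₁ e) × proj₂ e ≡ z)
Finite-×-fibre {Q = Q} z (ys , hys) = map (_, z) ys , λ e → to e , from e
  where
  to : ∀ e → Q (proj₁ e) × proj₂ e ≡ z → e ∈ map (_, z) ys
  to (y , .z) (Qy , refl) = ∈-map⁺ (_, z) (proj₁ (hys y) Qy)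

  from : ∀ e → e ∈ map (_, z) ys → Q (proj₁ e) × proj₂ e ≡ z
  from e e∈ with ∈-map⁻ (_, z) e∈
  ... | y , y∈ys , refl = proj₂ (hys y) y∈ys , refl

module _ {a ℓ} (𝓔 : EventStructure a ℓ) where
  open EventStructure 𝓔

  ≤-common⇒¬# : ∀ {e₁ e₁' e} → e₁ ≤ e → e₁' ≤ e → ¬ (e₁ # e₁')
  ≤-common⇒¬# {e = e} e₁≤e e₁'≤e e₁#e₁' =
    #-irrefl e (#-inherit (#-sym (#-inherit e₁#e₁' e₁'≤e)) e₁≤e)

  module _ (x : Cmax 𝓔) where
    private
      isFiniteConfig : IsFiniteConfig 𝓔 (proj₁ x)
      isFiniteConfig = proj₁ (proj₂ x)

    Cmax-conflictFree : ∀ {e e'} → proj₁ x e → proj₁ x e' → ¬ (e # e')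
    Cmax-conflictFree {e} {e'} = proj₁ (proj₁ isFiniteConfig) e e'

    Cmax-downClosed : ∀ {e e'} → e' ≤ e → proj₁ x e → proj₁ x e'
    Cmax-downClosed {e} {e'} = proj₂ (proj₁ isFiniteConfig) e e'

    Cmax-finite : Finite (proj₁ x)
    Cmax-finite = proj₂ isFiniteConfig

module SeqProperties {a₁ ℓ₁ a₂ ℓ₂} (𝓔₁ : EventStructure a₁ ℓ₁) (𝓔₂ : EventStructure a₂ ℓ₂) where
  private
    module E₁ = EventStructure 𝓔₁
    module E₂ = EventStructure 𝓔₂
  open Seq 𝓔₁ 𝓔₂

  ≤ₛ-refl : ∀ e → e ≤ₛ e
  ≤ₛ-refl (inj₁ e)       = ≤-left (E₁.≤-refl e)
  ≤ₛ-refl (inj₂ (e , x)) = ≤-right (E₂.≤-refl e)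

  ≤ₛ-antisym : ∀ {e e'} → e ≤ₛ e' → e' ≤ₛ e → e ≡ e'
  ≤ₛ-antisym (≤-left p)  (≤-left q)  = cong inj₁ (E₁.≤-antisym p q)
  ≤ₛ-antisym (≤-right p) (≤-right q) = cong (λ e → inj₂ (e , _)) (E₂.≤-antisym p q)

  ≤ₛ-trans : ∀ {e e' e''} → e ≤ₛ e' → e' ≤ₛ e'' → e ≤ₛ e''
  ≤ₛ-trans (≤-left p)  (≤-left q)            = ≤-left (E₁.≤-trans p q)
  ≤ₛ-trans (≤-left p)  (≤-cross {x = x} e∈x) = ≤-cross (Cmax-downClosed 𝓔₁ x p e∈x)
  ≤ₛ-trans (≤-right p) (≤-right q)           = ≤-right (E₂.≤-trans p q)
  ≤ₛ-trans (≤-cross e∈x) (≤-right _)         = ≤-cross e∈x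

  #ₛ-sym : ∀ {e e'} → e #ₛ e' → e' #ₛ e
  #ₛ-sym (#-left e₁ e₁' p q c) = #-left e₁' e₁ q p (E₁.#-sym c)
  #ₛ-sym (#-right c)           = #-right (E₂.#-sym c)

  #ₛ-irrefl : ∀ e → ¬ (e #ₛ e)
  #ₛ-irrefl (inj₁ e) (#-left _ _ (≤-left p) (≤-left q) c) = ≤-common⇒¬# 𝓔₁ p q c
  #ₛ-irrefl (inj₂ (e , x)) (#-left _ _ (≤-cross p) (≤-cross q) c) = Cmax-conflictFree 𝓔₁ x p q c
  #ₛ-irrefl (inj₂ (e , x)) (#-right c) = E₂.#-irrefl e c

  #ₛ-inherit : ∀ {e e' e''} → e #ₛ e' → e' ≤ₛ e'' → e #ₛ e''
  #ₛ-inherit (#-left e₁ e₁' p q c) r = #-left e₁ e₁' p (≤ₛ-trans q r) c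
  #ₛ-inherit (#-right c) (≤-right r) = #-right (E₂.#-inherit c r)

  finite-↓ₛ : ∀ e → Finite (λ e' → e' ≤ₛ e)
  finite-↓ₛ (inj₁ e) = Finite-⊎
    (Finite-resp (λ _ → ≤-left) (λ { _ (≤-left p) → p }) (E₁.finite-↓ e))
    (Finite-∅ λ _ ())
  finite-↓ₛ (inj₂ (e , x)) = Finite-⊎
    (Finite-resp (λ _ → ≤-cross) (λ { _ (≤-cross e∈x) → e∈x }) (Cmax-finite 𝓔₁ x))
    (Finite-resp (λ { _ (p , refl) → ≤-right p }) (λ { _ (≤-right p) → p , refl })
                 (Finite-×-fibre x (E₂.finite-↓ e)))

  isEventStructure : IsEventStructure SeqEv _≤ₛ_ _#ₛ_
  isEventStructure = record
    { ≤-refl    = ≤ₛ-refl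
    ; ≤-antisym = ≤ₛ-antisym
    ; ≤-trans   = ≤ₛ-trans
    ; #-sym     = #ₛ-sym
    ; #-irrefl  = #ₛ-irrefl
    ; finite-↓  = finite-↓ₛ
    ; #-inherit = #ₛ-inherit
    }

mainTheorem8 : ∀ {a₁ ℓ₁ a₂ ℓ₂} (𝓔₁ : EventStructure a₁ ℓ₁) (𝓔₂ : EventStructure a₂ ℓ₂)
    → IsEventStructure (Seq.SeqEv 𝓔₁ 𝓔₂) (Seq._≤ₛ_ 𝓔₁ 𝓔₂) (Seq._#ₛ_ 𝓔₁ 𝓔₂)
mainTheorem8 𝓔₁ 𝓔₂ = SeqProperties.isEventStructure 𝓔₁ 𝓔₂
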